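{- There exists a polynomial-time computable mapping $f$ from IPDL-formulas to variable-free IPDL-formulas such that for every IPDL-formula $\varphi$, $\varphi\in\mathbf{IPDL}$ (i.e. $\varphi$ is valid) if and only if $f(\varphi)\in\mathbf{IPDL}$.
   Context: IPDL (PDL with intersection): formulas and program terms are defined simultaneously by $\varphi ::= p \mid \bot \mid (\varphi\to\varphi)\mid [\alpha]\varphi$ and $\alpha ::= a \mid \varphi? \mid (\alpha;\alpha)\mid(\alpha\cup\alpha)\mid(\alpha\cap\alpha)\mid\alpha^*$, where $p$ ranges over a countable set of propositional variables and $a$ over a countable set of atomic program terms. A Kripke model is $\mathfrak{M}=(S,\{R_a\}_a,V)$ with $S$ nonempty, $R_a\subseteq S\times S$, $V$ mapping variables to subsets of $S$. $R_{\varphi?}=\{(s,s):\mathfrak{M},s\models\varphi\}$; $R_{\alpha;\beta}$ is relational composition; $R_{\alpha\cup\beta}=R_\alpha\cup R_\beta$; $R_{\alpha\cap\beta}=R_\alpha\cap R_\beta$; $R_{\alpha^*}$ is the reflexive transitive closure of $R_\alpha$; $\mathfrak{M},s\models p$ iff $s\in V(p)$; $\bot$ never true; $\to$ classical; $\mathfrak{M},s\models[\alpha]\varphi$ iff $\varphi$ holds at all $t$ with $(s,t)\in R_\alpha$. A formula is valid if true at every state of every model; $\mathbf{IPDL}$ denotes the set of valid formulas. A formula is variable-free if it contains no propositional variables; the variable-free fragment is the set of variable-free valid formulas. -}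

module Defs where

open import Data.Nat using (ℕ; zero; suc; _+_; _*_; _^_; _≤_)
open import Data.Nat.Binary using (ℕᵇ; 2[1+_]; 1+[2_]) renaming (zero to zeroᵇ; fromℕ to toBin)
open import Data.Bool using (Bool; true; false)
open import Data.Fin using (Fin)
open import Data.Maybe using (Maybe; just; nothing)
open import Data.Sum using (_⊎_; inj₁; inj₂)
open import Data.Product using (Σ; _×_; _,_)
open import Data.List using (List; []; _∷_; _++_; length; map)
open import Data.Empty using (⊥)
open import Data.Unit using (⊤)
open import Relation.Binary.PropositionalEquality using (_≡_)
open import Relation.Binary.Construct.Closure.ReflexiveTransitive using (Star)

mutual
  data Fm : Set where
    var  : ℕ → Fm
    ⊥'   : Fm
    _⇒_  : Fm → Fm → Fm
    [_]_ : Pr → Fm → Fm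

  data Pr : Set where
    atom : ℕ → Pr
    _¿   : Fm → Pr
    _⨾_  : Pr → Pr → Pr
    _∪'_ : Pr → Pr → Pr
    _∩'_ : Pr → Pr → Pr
    _⋆   : Pr → Pr

-- Kripke semantics.  Valuations are Bool-valued (classical atoms);
-- truth is then ¬¬-stable, so this coincides with classical semantics.

record Model : Set₁ where
  field
    S : Set
    R : ℕ → S → S → Set
    V : ℕ → S → Bool

open Model public

mutual
  _,_⊨_ : (M : Model) → S M → Fm → Set
  M , s ⊨ var p   = V M p s ≡ true
  M , s ⊨ ⊥'      = ⊥
  M , s ⊨ (φ ⇒ ψ) = M , s ⊨ φ → M , s ⊨ ψ
  M , s ⊨ ([ α ] φ) = (t : S M) → Rel M α s t → M , t ⊨ φ

  Rel : (M : Model) → Pr → S M → S M → Set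
  Rel M (atom a) s t  = R M a s t
  Rel M (φ ¿) s t     = (s ≡ t) × (M , s ⊨ φ)
  Rel M (α ⨾ β) s t   = Σ (S M) λ u → Rel M α s u × Rel M β u t
  Rel M (α ∪' β) s t  = Rel M α s t ⊎ Rel M β s t
  Rel M (α ∩' β) s t  = Rel M α s t × Rel M β s t
  Rel M (α ⋆) s t     = Star (Rel M α) s t

Valid : Fm → Set₁
Valid φ = (M : Model) (s : S M) → M , s ⊨ φ

mutual
  VarFree : Fm → Set
  VarFree (var p)   = ⊥
  VarFree ⊥'        = ⊤
  VarFree (φ ⇒ ψ)   = VarFree φ × VarFree ψ
  VarFree ([ α ] φ) = VarFreeP α × VarFree φ

  VarFreeP : Pr → Set
  VarFreeP (atom a) = ⊤
  VarFreeP (φ ¿)    = VarFree φ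
  VarFreeP (α ⨾ β)  = VarFreeP α × VarFreeP β
  VarFreeP (α ∪' β) = VarFreeP α × VarFreeP β
  VarFreeP (α ∩' β) = VarFreeP α × VarFreeP β
  VarFreeP (α ⋆)    = VarFreeP α

-- Standard string encoding of formulas (Polish notation, indices in
-- bijective binary followed by an end marker).

data Sym : Set where
  sP sA sBot sImp sBox sTest sSeq sCup sCap sStar s1 s2 sEnd : Sym

bits : ℕᵇ → List Sym
bits zeroᵇ    = []
bits 2[1+ x ] = s2 ∷ bits x
bits 1+[2 x ] = s1 ∷ bits x

encℕ : ℕ → List Sym
encℕ n = bits (toBin n) ++ (sEnd ∷ [])

mutual
  encF : Fm → List Sym
  encF (var p)   = sP ∷ encℕ p
  encF ⊥'        = sBot ∷ []
  encF (φ ⇒ ψ)   = sImp ∷ encF φ ++ encF ψ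
  encF ([ α ] φ) = sBox ∷ encP α ++ encF φ

  encP : Pr → List Sym
  encP (atom a) = sA ∷ encℕ a
  encP (φ ¿)    = sTest ∷ encF φ
  encP (α ⨾ β)  = sSeq ∷ encP α ++ encP β
  encP (α ∪' β) = sCup ∷ encP α ++ encP β
  encP (α ∩' β) = sCap ∷ encP α ++ encP β
  encP (α ⋆)    = sStar ∷ encP α

-- Deterministic single-tape Turing machines (one-way infinite tape).
-- Tape symbols: nothing = blank, just (inj₁ s) = input symbol,
-- just (inj₂ g) = auxiliary work symbol.

data Move : Set where
  L N R' : Move

record TM : Set where
  field
    nQ    : ℕ
    nΓ    : ℕ
    start : Fin nQ
    halt  : Fin nQ → Bool
    δ     : Fin nQ → Maybe (Sym ⊎ Fin nΓ) → Fin nQ × Maybe (Sym ⊎ Fin nΓ) × Move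

module _ (M : TM) where
  open TM M

  TSym : Set
  TSym = Maybe (Sym ⊎ Fin nΓ)

  record Config : Set where
    constructor conf
    field
      state : Fin nQ
      left  : List TSym   -- cells left of the head, nearest first
      cur   : TSym
      right : List TSym   -- cells right of the head (then blanks)

  move : Move → List TSym → TSym → List TSym → Config → Config
  move L  []       c r (conf q _ _ _) = conf q [] c r
  move L  (x ∷ l)  c r (conf q _ _ _) = conf q l x (c ∷ r)
  move N  l        c r (conf q _ _ _) = conf q l c r
  move R' l        c []      (conf q _ _ _) = conf q (c ∷ l) nothing []
  move R' l        c (x ∷ r) (conf q _ _ _) = conf q (c ∷ l) x r

  stepWith : Bool → Config → Config
  stepWith true  k = k
  stepWith false (conf q l c r) with δ q c
  ... | q' , c' , m = move m l c' r (conf q' l c' r)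

  step : Config → Config
  step k = stepWith (halt (Config.state k)) k

  run : ℕ → Config → Config
  run zero    k = k
  run (suc t) k = run t (step k)

  initial : List Sym → Config
  initial []      = conf start [] nothing []
  initial (x ∷ w) = conf start [] (just (inj₁ x)) (map (λ y → just (inj₁ y)) w)

  Halted : Config → Set
  Halted k = halt (Config.state k) ≡ true

  upToBlank : List TSym → List TSym
  upToBlank []            = []
  upToBlank (nothing ∷ _) = []
  upToBlank (just x ∷ xs) = just x ∷ upToBlank xs

  output : Config → List TSym
  output (conf _ _ c r) = upToBlank (c ∷ r)

PolyTime : (Fm → Fm) → Set
PolyTime f =
  Σ TM λ M → Σ ℕ λ c → Σ ℕ λ d → (φ : Fm) → Σ ℕ λ t →
    (t ≤ c * length (encF φ) ^ d + c) ×
    Halted M (run M t (initial M (encF φ))) ×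
    (output M (run M t (initial M (encF φ)))
       ≡ map (λ y → just (inj₁ y)) (encF (f φ)))

module Submission where

-- The reduction replaces every propositional variable pᵢ by [⊤? ∩ a₂ᵢ₊₂]⊥
-- ("there is no a₂ᵢ₊₂-loop here") and renames every atomic program aⱼ to
-- a₂ⱼ₊₁, so the variables become fresh atomic programs.
--
-- From a model M we build a model in which a₂ᵢ₊₂ loops exactly
--    at the states refuting pᵢ; there the translation of φ means φ (so
--    validity is reflected).  From a model of the translated language we
--    build a model whose states carry the truth values of the finitely many
--    relevant coded variables; choosing them is classical, so this direction
--    runs in the double-negation monad and ends by stability of truth
--    (so validity is preserved).
-- 2. Encodings.  On the standard string encoding the reduction is a
--    letter-to-string transducer with one bit of memory, inserting at most
--    seven symbols after each input symbol.
-- 3. Complexity.  A single-tape Turing machine runs this transducer in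
--    place, shifting the remaining input right for each inserted symbol;
--    it needs at most 60·n² + 60 steps on inputs of length n.

open import Defs
open import Level using (0ℓ)
open import Data.Nat using (ℕ; zero; suc; _+_; _*_; _^_; _<_; _≤_; z≤n; s≤s; _⊔_)
open import Data.Nat.Properties
  using (≤-refl; ≤-reflexive; ≤-trans; <-≤-trans; n≤1+n; suc-injective; m≤m⊔n; m≤n⊔m; m≤m+n;
         +-mono-≤; +-monoˡ-≤; +-monoʳ-≤; *-monoˡ-≤; *-monoʳ-≤)
open import Data.Nat.Tactic.RingSolver using (solve-∀)
open import Data.Nat.Binary using (ℕᵇ; 2[1+_]; 1+[2_]; toℕ) renaming (zero to zeroᵇ; fromℕ to toBin)
open import Data.Nat.Binary.Properties using (fromℕ-toℕ; toℕ-fromℕ)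
open import Data.Bool using (Bool; true; false)
open import Data.Fin using (Fin; #_; join; splitAt; combine; remQuot)
open import Data.Fin.Properties using (splitAt-join; remQuot-combine)
open import Data.Vec using (Vec; []; _∷_; lookup)
open import Data.List using (List; []; _∷_; _++_; _ʳ++_; length; map)
open import Data.List.Properties using (++-assoc; ++-identityʳ; ++-ʳ++; length-map; length-++; map-++)
open import Data.List.Relation.Unary.All using (All; []; _∷_)
open import Data.Maybe using (Maybe; just; nothing)
open import Data.Sum using (_⊎_; inj₁; inj₂) renaming (map to map⊎)
open import Data.Product using (Σ; _×_; _,_; proj₁; proj₂)
open import Data.Empty using (⊥)
open import Data.Unit using (⊤; tt)
open import Function using (id)
open import Function.Bundles using (_⇔_; mk⇔; Equivalence)
open import Relation.Nullary using (Dec; yes; no; Stable)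
open import Relation.Nullary.Negation using (DoubleNegation; ¬¬-Monad; contradiction)
open import Relation.Nullary.Decidable using (¬¬-excluded-middle)
open import Relation.Binary.PropositionalEquality
  using (_≡_; refl; sym; trans; cong; cong₂; subst; module ≡-Reasoning)
open import Relation.Binary.Construct.Closure.ReflexiveTransitive using (Star; ε; _◅_) renaming (map to Star-map)
open import Effect.Monad using (RawMonad)

open Equivalence using (to; from)
open RawMonad (¬¬-Monad {0ℓ}) using (pure; _>>=_)
open ≡-Reasoning

verum : Fm
verum = ⊥' ⇒ ⊥'

-- Both codes are built from binary constructors, so
-- their standard encodings are the old index with one digit prepended.
atomCode : ℕ → ℕ
atomCode j = toℕ (1+[2 toBin j ])

varCode : ℕ → ℕ
varCode i = toℕ (2[1+ toBin i ])

mutual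
  translate : Fm → Fm
  translate (var i)   = [ (verum ¿) ∩' atom (varCode i) ] ⊥'
  translate ⊥'        = ⊥'
  translate (φ ⇒ ψ)   = translate φ ⇒ translate ψ
  translate ([ α ] φ) = [ translateP α ] translate φ

  translateP : Pr → Pr
  translateP (atom a) = atom (atomCode a)
  translateP (φ ¿)    = translate φ ¿
  translateP (α ⨾ β)  = translateP α ⨾ translateP β
  translateP (α ∪' β) = translateP α ∪' translateP β
  translateP (α ∩' β) = translateP α ∩' translateP β
  translateP (α ⋆)    = translateP α ⋆

mutual
  translate-varFree : ∀ φ → VarFree (translate φ)
  translate-varFree (var i)   = ((tt , tt) , tt) , tt
  translate-varFree ⊥'        = tt
  translate-varFree (φ ⇒ ψ)   = translate-varFree φ , translate-varFree ψ
  translate-varFree ([ α ] φ) = translateP-varFree α , translate-varFree φ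

  translateP-varFree : ∀ α → VarFreeP (translateP α)
  translateP-varFree (atom a) = tt
  translateP-varFree (φ ¿)    = translate-varFree φ
  translateP-varFree (α ⨾ β)  = translateP-varFree α , translateP-varFree β
  translateP-varFree (α ∪' β) = translateP-varFree α , translateP-varFree β
  translateP-varFree (α ∩' β) = translateP-varFree α , translateP-varFree β
  translateP-varFree (α ⋆)    = translateP-varFree α

-- A model M of the original language is
-- turned into a model loopModel M of the translated one: a₂ⱼ₊₁ is Rⱼ and
-- a₂ᵢ₊₂ is the identity on the states refuting pᵢ.
module Loops (M : Model) where

  loopRel : ℕᵇ → S M → S M → Set
  loopRel zeroᵇ    s t = ⊥
  loopRel 2[1+ i ] s t = (s ≡ t) × (V M (toℕ i) s ≡ false)
  loopRel 1+[2 j ] s t = R M (toℕ j) s t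

  loopModel : Model
  loopModel = record { S = S M ; R = λ k → loopRel (toBin k) ; V = V M }

  atomCode-rel : ∀ j {s t} → Rel loopModel (atom (atomCode j)) s t ≡ R M j s t
  atomCode-rel j rewrite fromℕ-toℕ (1+[2 toBin j ]) | toℕ-fromℕ j = refl

  varCode-rel : ∀ i {s t} → Rel loopModel (atom (varCode i)) s t ≡ ((s ≡ t) × (V M i s ≡ false))
  varCode-rel i rewrite fromℕ-toℕ (2[1+ toBin i ]) | toℕ-fromℕ i = refl

  var-truth : ∀ i s → (loopModel , s ⊨ translate (var i)) ⇔ (V M i s ≡ true)
  var-truth i s = mk⇔ no-loop⇒true true⇒no-loop
    where
    no-loop⇒true : loopModel , s ⊨ translate (var i) → V M i s ≡ true
    no-loop⇒true h with V M i s in eq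
    ... | true  = refl
    ... | false = contradiction ((refl , id) , subst id (sym (varCode-rel i)) (refl , eq)) (h s)

    true⇒no-loop : V M i s ≡ true → loopModel , s ⊨ translate (var i)
    true⇒no-loop vi t (_ , loop) with subst id (varCode-rel i) loop
    ... | _ , vi-false = contradiction (trans (sym vi) vi-false) λ ()

  mutual
    truth : ∀ φ s → (loopModel , s ⊨ translate φ) ⇔ (M , s ⊨ φ)
    truth (var i)   s = var-truth i s
    truth ⊥'        s = mk⇔ id id
    truth (φ ⇒ ψ)   s = mk⇔ (λ h a → to (truth ψ s) (h (from (truth φ s) a)))
                            (λ h a → from (truth ψ s) (h (to (truth φ s) a)))
    truth ([ α ] φ) s = mk⇔ (λ h t r → to (truth φ t) (h t (from (relation α) r)))
                            (λ h t r → from (truth φ t) (h t (to (relation α) r)))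

    relation : ∀ α {s t} → Rel loopModel (translateP α) s t ⇔ Rel M α s t
    relation (atom a)     = mk⇔ (subst id (atomCode-rel a)) (subst id (sym (atomCode-rel a)))
    relation (φ ¿) {s}    = mk⇔ (λ (e , h) → e , to (truth φ s) h) (λ (e , h) → e , from (truth φ s) h)
    relation (α ⨾ β)      = mk⇔ (λ (u , r , r') → u , to (relation α) r , to (relation β) r')
                                (λ (u , r , r') → u , from (relation α) r , from (relation β) r')
    relation (α ∪' β)     = mk⇔ (λ { (inj₁ r) → inj₁ (to (relation α) r) ; (inj₂ r) → inj₂ (to (relation β) r) })
                                (λ { (inj₁ r) → inj₁ (from (relation α) r) ; (inj₂ r) → inj₂ (from (relation β) r) })
    relation (α ∩' β)     = mk⇔ (λ (r , r') → to (relation α) r , to (relation β) r')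
                                (λ (r , r') → from (relation α) r , from (relation β) r')
    relation (α ⋆)        = mk⇔ (Star-map (to (relation α))) (Star-map (from (relation α)))

validity-reflected : ∀ φ → Valid (translate φ) → Valid φ
validity-reflected φ h M s = to (Loops.truth M φ s) (h (Loops.loopModel M) s)

-- Conversely a model M' of the translated
-- language yields a model of the original one whose states are pairs of a
-- state of M' and the vector of truth values of the coded variables p₀…p_{K-1}
-- at it; K bounds the variables of φ.  Choosing these vectors is classical,
-- hence the argument runs in the ¬¬-monad and concludes by ⊨-stable.

-- Truth is ¬¬-stable, since valuations are Boolean.
bool-stable : (b : Bool) → Stable (b ≡ true)
bool-stable true  _   = refl
bool-stable false ¬¬b = contradiction (λ ()) ¬¬b

⊨-stable : (M : Model) (s : S M) (φ : Fm) → Stable (M , s ⊨ φ)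
⊨-stable M s (var p)   ¬¬h   = bool-stable (V M p s) ¬¬h
⊨-stable M s ⊥'        ¬¬h   = ¬¬h id
⊨-stable M s (φ ⇒ ψ)   ¬¬h a = ⊨-stable M s ψ λ ¬b → ¬¬h λ h → ¬b (h a)
⊨-stable M s ([ α ] φ) ¬¬h t r = ⊨-stable M t φ λ ¬b → ¬¬h λ h → ¬b (h t r)

mutual
  VarsBelow : ℕ → Fm → Set
  VarsBelow K (var i)   = i < K
  VarsBelow K ⊥'        = ⊤
  VarsBelow K (φ ⇒ ψ)   = VarsBelow K φ × VarsBelow K ψ
  VarsBelow K ([ α ] φ) = VarsBelowP K α × VarsBelow K φ

  VarsBelowP : ℕ → Pr → Set
  VarsBelowP K (atom a) = ⊤
  VarsBelowP K (φ ¿)    = VarsBelow K φ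
  VarsBelowP K (α ⨾ β)  = VarsBelowP K α × VarsBelowP K β
  VarsBelowP K (α ∪' β) = VarsBelowP K α × VarsBelowP K β
  VarsBelowP K (α ∩' β) = VarsBelowP K α × VarsBelowP K β
  VarsBelowP K (α ⋆)    = VarsBelowP K α

mutual
  varsBelow-mono : ∀ {K K'} φ → K ≤ K' → VarsBelow K φ → VarsBelow K' φ
  varsBelow-mono (var i)   le b        = <-≤-trans b le
  varsBelow-mono ⊥'        le b        = tt
  varsBelow-mono (φ ⇒ ψ)   le (b , b') = varsBelow-mono φ le b , varsBelow-mono ψ le b'
  varsBelow-mono ([ α ] φ) le (b , b') = varsBelowP-mono α le b , varsBelow-mono φ le b'

  varsBelowP-mono : ∀ {K K'} α → K ≤ K' → VarsBelowP K α → VarsBelowP K' α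
  varsBelowP-mono (atom a) le b        = tt
  varsBelowP-mono (φ ¿)    le b        = varsBelow-mono φ le b
  varsBelowP-mono (α ⨾ β)  le (b , b') = varsBelowP-mono α le b , varsBelowP-mono β le b'
  varsBelowP-mono (α ∪' β) le (b , b') = varsBelowP-mono α le b , varsBelowP-mono β le b'
  varsBelowP-mono (α ∩' β) le (b , b') = varsBelowP-mono α le b , varsBelowP-mono β le b'
  varsBelowP-mono (α ⋆)    le b        = varsBelowP-mono α le b

common-bound : {P Q : ℕ → Set} →
               (∀ {K K'} → K ≤ K' → P K → P K') → (∀ {K K'} → K ≤ K' → Q K → Q K') →
               Σ ℕ P → Σ ℕ Q → Σ ℕ λ K → P K × Q K
common-bound P-mono Q-mono (K , p) (K' , q) =
  K ⊔ K' , P-mono (m≤m⊔n K K') p , Q-mono (m≤n⊔m K K') q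

mutual
  varBound : ∀ φ → Σ ℕ λ K → VarsBelow K φ
  varBound (var i)   = suc i , ≤-refl
  varBound ⊥'        = 0 , tt
  varBound (φ ⇒ ψ)   = common-bound (varsBelow-mono φ) (varsBelow-mono ψ) (varBound φ) (varBound ψ)
  varBound ([ α ] φ) = common-bound (varsBelowP-mono α) (varsBelow-mono φ) (varBoundP α) (varBound φ)

  varBoundP : ∀ α → Σ ℕ λ K → VarsBelowP K α
  varBoundP (atom a) = 0 , tt
  varBoundP (φ ¿)    = varBound φ
  varBoundP (α ⨾ β)  = common-bound (varsBelowP-mono α) (varsBelowP-mono β) (varBoundP α) (varBoundP β)
  varBoundP (α ∪' β) = common-bound (varsBelowP-mono α) (varsBelowP-mono β) (varBoundP α) (varBoundP β)
  varBoundP (α ∩' β) = common-bound (varsBelowP-mono α) (varsBelowP-mono β) (varBoundP α) (varBoundP β)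
  varBoundP (α ⋆)    = varBoundP α

-- The i-th entry of a bit vector (false beyond its length).
bitAt : ∀ {K} → Vec Bool K → ℕ → Bool
bitAt []      i       = false
bitAt (x ∷ b) zero    = x
bitAt (x ∷ b) (suc i) = bitAt b i

Records : ∀ {K} → (ℕ → Set) → Vec Bool K → Set
Records {K} Q b = ∀ i → i < K → (bitAt b i ≡ true) ⇔ Q i

bit-of : ∀ {A : Set} → Dec A → Σ Bool λ x → (x ≡ true) ⇔ A
bit-of (yes a) = true  , mk⇔ (λ _ → a) (λ _ → refl)
bit-of (no ¬a) = false , mk⇔ (λ ()) (λ a → contradiction a ¬a)

bit-unique : ∀ {A : Set} x y → (x ≡ true) ⇔ A → (y ≡ true) ⇔ A → x ≡ y
bit-unique true  true  _  _  = refl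
bit-unique false false _  _  = refl
bit-unique true  false hx hy = sym (from hy (to hx refl))
bit-unique false true  hx hy = from hx (to hy refl)

records-exist : ∀ K (Q : ℕ → Set) → DoubleNegation (Σ (Vec Bool K) (Records Q))
records-exist zero    Q = pure ([] , λ i ())
records-exist (suc K) Q = do
  (b , rec) ← records-exist K (λ i → Q (suc i))
  q? ← ¬¬-excluded-middle
  let (x , x⇔q) = bit-of q?
  pure (x ∷ b , λ { zero _ → x⇔q ; (suc i) (s≤s i<K) → rec i i<K })

records-unique : ∀ {K} (Q : ℕ → Set) (b c : Vec Bool K) → Records Q b → Records Q c → b ≡ c
records-unique Q []      []      _   _   = refl
records-unique Q (x ∷ b) (y ∷ c) rec rec' =
  cong₂ _∷_ (bit-unique x y (rec 0 (s≤s z≤n)) (rec' 0 (s≤s z≤n)))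
            (records-unique (λ i → Q (suc i)) b c (λ i l → rec (suc i) (s≤s l)) (λ i l → rec' (suc i) (s≤s l)))

module Valuations (M' : Model) (K : ℕ) where

  Coded : S M' → ℕ → Set
  Coded s i = M' , s ⊨ translate (var i)

  Fits : S M' → Vec Bool K → Set
  Fits s b = Records (Coded s) b

  -- States are (s , b) with b meant to fit s; an a_j-step of the new model
  -- is an a₂ⱼ₊₁-step of M' into a fitting pair.
  pairModel : Model
  pairModel = record
    { S = S M' × Vec Bool K
    ; R = λ j x y → R M' (atomCode j) (proj₁ x) (proj₁ y) × Fits (proj₁ y) (proj₂ y)
    ; V = λ i x → bitAt (proj₂ x) i }

  fitting : ∀ t → DoubleNegation (Σ (Vec Bool K) (Fits t))
  fitting t = records-exist K (Coded t)

  mutual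
    truth⁺ : ∀ φ → VarsBelow K φ → ∀ {s b} → Fits s b → M' , s ⊨ translate φ → pairModel , (s , b) ⊨ φ
    truth⁺ (var i)   i<K     fits h = from (fits i i<K) h
    truth⁺ ⊥'        _       fits h = h
    truth⁺ (φ ⇒ ψ)   (bφ , bψ) fits h a = truth⁺ ψ bψ fits (h (truth⁻ φ bφ fits a))
    truth⁺ ([ α ] φ) (bα , bφ) fits h (t , c) r =
      let (r' , fits') = project α bα r fits in truth⁺ φ bφ fits' (h t r')

    truth⁻ : ∀ φ → VarsBelow K φ → ∀ {s b} → Fits s b → pairModel , (s , b) ⊨ φ → M' , s ⊨ translate φ
    truth⁻ (var i)   i<K     fits h = to (fits i i<K) h
    truth⁻ ⊥'        _       fits h = h
    truth⁻ (φ ⇒ ψ)   (bφ , bψ) fits h a = truth⁻ ψ bψ fits (h (truth⁺ φ bφ fits a))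
    truth⁻ ([ α ] φ) (bα , bφ) fits h t r = ⊨-stable M' t (translate φ) do
      (c , fits' , r') ← lift α bα r fits
      pure (truth⁻ φ bφ fits' (h (t , c) r'))

    project : ∀ α → VarsBelowP K α → ∀ {s b t c} → Rel pairModel α (s , b) (t , c) → Fits s b →
              Rel M' (translateP α) s t × Fits t c
    project (atom a)  _         r                 fits = r
    project (φ ¿)     bφ        (refl , h)        fits = (refl , truth⁻ φ bφ fits h) , fits
    project (α ⨾ β)   (bα , bβ) ((u , d) , r , r') fits =
      let (q , fits₁) = project α bα r fits
          (q' , fits₂) = project β bβ r' fits₁
      in (u , q , q') , fits₂
    project (α ∪' β)  (bα , bβ) (inj₁ r)          fits = let (q , fits') = project α bα r fits in inj₁ q , fits'
    project (α ∪' β)  (bα , bβ) (inj₂ r)          fits = let (q , fits') = project β bβ r fits in inj₂ q , fits'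
    project (α ∩' β)  (bα , bβ) (r , r')          fits =
      let (q , fits') = project α bα r fits in (q , proj₁ (project β bβ r' fits)) , fits'
    project (α ⋆)     bα        rs                fits = project⋆ α bα rs fits

    project⋆ : ∀ α → VarsBelowP K α → ∀ {s b t c} → Star (Rel pairModel α) (s , b) (t , c) → Fits s b →
               Star (Rel M' (translateP α)) s t × Fits t c
    project⋆ α bα ε                        fits = ε , fits
    project⋆ α bα (_◅_ {j = (u , d)} r rs) fits =
      let (q , fits₁) = project α bα r fits
          (qs , fits₂) = project⋆ α bα rs fits₁
      in (q ◅ qs) , fits₂

    lift : ∀ α → VarsBelowP K α → ∀ {s b t} → Rel M' (translateP α) s t → Fits s b →
           DoubleNegation (Σ (Vec Bool K) λ c → Fits t c × Rel pairModel α (s , b) (t , c))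
    lift (atom a) _ {t = t} r fits = do
      (c , fits') ← fitting t
      pure (c , fits' , r , fits')
    lift (φ ¿) bφ {b = b} (refl , h) fits = pure (b , fits , refl , truth⁺ φ bφ fits h)
    lift (α ⨾ β) (bα , bβ) (u , r , r') fits = do
      (d , fits₁ , q) ← lift α bα r fits
      (c , fits₂ , q') ← lift β bβ r' fits₁
      pure (c , fits₂ , (u , d) , q , q')
    lift (α ∪' β) (bα , bβ) (inj₁ r) fits = do
      (c , fits' , q) ← lift α bα r fits
      pure (c , fits' , inj₁ q)
    lift (α ∪' β) (bα , bβ) (inj₂ r) fits = do
      (c , fits' , q) ← lift β bβ r fits
      pure (c , fits' , inj₂ q)
    lift (α ∩' β) (bα , bβ) {t = t} (r , r') fits = do
      (c , fits₁ , q) ← lift α bα r fits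
      (c' , fits₂ , q') ← lift β bβ r' fits
      -- both liftings fit t, hence they end in the same pair
      let c'≡c = records-unique (Coded t) c' c fits₂ fits₁
      pure (c , fits₁ , q , subst (λ z → Rel pairModel β _ (t , z)) c'≡c q')
    lift (α ⋆) bα rs fits = lift⋆ α bα rs fits

    lift⋆ : ∀ α → VarsBelowP K α → ∀ {s b t} → Star (Rel M' (translateP α)) s t → Fits s b →
            DoubleNegation (Σ (Vec Bool K) λ c → Fits t c × Star (Rel pairModel α) (s , b) (t , c))
    lift⋆ α bα {b = b} ε fits = pure (b , fits , ε)
    lift⋆ α bα (r ◅ rs) fits = do
      (d , fits₁ , q) ← lift α bα r fits
      (c , fits₂ , qs) ← lift⋆ α bα rs fits₁
      pure (c , fits₂ , q ◅ qs)

validity-preserved : ∀ φ → Valid φ → Valid (translate φ)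
validity-preserved φ h M' s = ⊨-stable M' s (translate φ) do
  (b , fits) ← fitting s
  pure (truth⁻ φ bound fits (h pairModel (s , b)))
  where
  K : ℕ
  K = proj₁ (varBound φ)
  bound : VarsBelow K φ
  bound = proj₂ (varBound φ)
  open Valuations M' K

-- On encodings the reduction is a letter-to-string transducer with one bit
-- of memory ("inside the index of a variable"): sP becomes
-- sBox sCap sTest sImp sBot sBot sA s2, sA gets the digit s1 appended, and
-- the end marker of a variable index is followed by sBot.  Pending names
-- the nonempty strings inserted after a written symbol (var7 … var1 are the
-- suffixes of the string inserted after sBox).
data Pending : Set where
  var7 var6 var5 var4 var3 var2 var1 atom1 end1 : Pending

pendingSyms : Pending → List Sym
pendingSyms var7  = sCap ∷ sTest ∷ sImp ∷ sBot ∷ sBot ∷ sA ∷ s2 ∷ []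
pendingSyms var6  = sTest ∷ sImp ∷ sBot ∷ sBot ∷ sA ∷ s2 ∷ []
pendingSyms var5  = sImp ∷ sBot ∷ sBot ∷ sA ∷ s2 ∷ []
pendingSyms var4  = sBot ∷ sBot ∷ sA ∷ s2 ∷ []
pendingSyms var3  = sBot ∷ sA ∷ s2 ∷ []
pendingSyms var2  = sA ∷ s2 ∷ []
pendingSyms var1  = s2 ∷ []
pendingSyms atom1 = s1 ∷ []
pendingSyms end1  = sBot ∷ []

inserted : Maybe Pending → List Sym
inserted nothing  = []
inserted (just p) = pendingSyms p

emit : Bool → Sym → Bool × Sym × Maybe Pending
emit m     sP   = true , sBox , just var7
emit m     sA   = m , sA , just atom1
emit true  sEnd = false , sEnd , just end1
emit false sEnd = false , sEnd , nothing
emit m     x    = m , x , nothing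

transduce : Bool → List Sym → List Sym
transduce m []      = []
transduce m (x ∷ w) with emit m x
... | m' , y , ins = y ∷ inserted ins ++ transduce m' w

transduce-bits : ∀ m b ys → transduce m (bits b ++ ys) ≡ bits b ++ transduce m ys
transduce-bits m zeroᵇ     ys = refl
transduce-bits m 2[1+ x ] ys = cong (s2 ∷_) (transduce-bits m x ys)
transduce-bits m 1+[2 x ] ys = cong (s1 ∷_) (transduce-bits m x ys)

encℕ-atomCode : ∀ j → encℕ (atomCode j) ≡ s1 ∷ encℕ j
encℕ-atomCode j rewrite fromℕ-toℕ (1+[2 toBin j ]) = refl

encℕ-varCode : ∀ i → encℕ (varCode i) ≡ s2 ∷ encℕ i
encℕ-varCode i rewrite fromℕ-toℕ (2[1+ toBin i ]) = refl

afterIndex : Bool → List Sym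
afterIndex true  = sBot ∷ []
afterIndex false = []

transduce-encℕ : ∀ m n ys → transduce m (encℕ n ++ ys) ≡ encℕ n ++ afterIndex m ++ transduce false ys
transduce-encℕ m n ys = begin
    transduce m ((bits (toBin n) ++ sEnd ∷ []) ++ ys)
  ≡⟨ cong (transduce m) (++-assoc (bits (toBin n)) (sEnd ∷ []) ys) ⟩
    transduce m (bits (toBin n) ++ sEnd ∷ ys)
  ≡⟨ transduce-bits m (toBin n) (sEnd ∷ ys) ⟩
    bits (toBin n) ++ transduce m (sEnd ∷ ys)
  ≡⟨ cong (bits (toBin n) ++_) (transduce-end m) ⟩
    bits (toBin n) ++ sEnd ∷ afterIndex m ++ transduce false ys
  ≡⟨ ++-assoc (bits (toBin n)) (sEnd ∷ []) _ ⟨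
    encℕ n ++ afterIndex m ++ transduce false ys
  ∎
  where
  transduce-end : ∀ m → transduce m (sEnd ∷ ys) ≡ sEnd ∷ afterIndex m ++ transduce false ys
  transduce-end true  = refl
  transduce-end false = refl

Copied : Sym → Set
Copied s = ∀ r → transduce false (s ∷ r) ≡ s ∷ transduce false r

transduce-node : ∀ s u u' v v' → Copied s →
                 (∀ ys → transduce false (u ++ ys) ≡ u' ++ transduce false ys) →
                 (∀ ys → transduce false (v ++ ys) ≡ v' ++ transduce false ys) →
                 ∀ ys → transduce false ((s ∷ u ++ v) ++ ys) ≡ (s ∷ u' ++ v') ++ transduce false ys
transduce-node s u u' v v' copied hu hv ys = begin
    transduce false (s ∷ (u ++ v) ++ ys)
  ≡⟨ copied _ ⟩
    s ∷ transduce false ((u ++ v) ++ ys)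
  ≡⟨ cong (λ z → s ∷ transduce false z) (++-assoc u v ys) ⟩
    s ∷ transduce false (u ++ v ++ ys)
  ≡⟨ cong (s ∷_) (hu (v ++ ys)) ⟩
    s ∷ u' ++ transduce false (v ++ ys)
  ≡⟨ cong (λ z → s ∷ u' ++ z) (hv ys) ⟩
    s ∷ u' ++ v' ++ transduce false ys
  ≡⟨ cong (s ∷_) (++-assoc u' v' _) ⟨
    (s ∷ u' ++ v') ++ transduce false ys
  ∎

mutual
  transduce-translate : ∀ φ ys → transduce false (encF φ ++ ys) ≡ encF (translate φ) ++ transduce false ys
  transduce-translate (var i) ys =
    cong (λ z → sBox ∷ sCap ∷ sTest ∷ sImp ∷ sBot ∷ sBot ∷ sA ∷ z) (begin
      s2 ∷ transduce true (encℕ i ++ ys)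
    ≡⟨ cong (s2 ∷_) (transduce-encℕ true i ys) ⟩
      (s2 ∷ encℕ i) ++ sBot ∷ transduce false ys
    ≡⟨ cong (_++ sBot ∷ transduce false ys) (encℕ-varCode i) ⟨
      encℕ (varCode i) ++ sBot ∷ transduce false ys
    ≡⟨ ++-assoc (encℕ (varCode i)) (sBot ∷ []) _ ⟨
      (encℕ (varCode i) ++ sBot ∷ []) ++ transduce false ys
    ∎)
  transduce-translate ⊥'        ys = refl
  transduce-translate (φ ⇒ ψ)   ys =
    transduce-node sImp _ _ _ _ (λ _ → refl) (transduce-translate φ) (transduce-translate ψ) ys
  transduce-translate ([ α ] φ) ys =
    transduce-node sBox _ _ _ _ (λ _ → refl) (transduce-translateP α) (transduce-translate φ) ys

  transduce-translateP : ∀ α ys → transduce false (encP α ++ ys) ≡ encP (translateP α) ++ transduce false ys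
  transduce-translateP (atom j) ys = cong (λ z → sA ∷ z) (begin
      s1 ∷ transduce false (encℕ j ++ ys)
    ≡⟨ cong (s1 ∷_) (transduce-encℕ false j ys) ⟩
      (s1 ∷ encℕ j) ++ transduce false ys
    ≡⟨ cong (_++ transduce false ys) (encℕ-atomCode j) ⟨
      encℕ (atomCode j) ++ transduce false ys
    ∎)
  transduce-translateP (φ ¿)    ys = cong (sTest ∷_) (transduce-translate φ ys)
  transduce-translateP (α ⨾ β)  ys =
    transduce-node sSeq _ _ _ _ (λ _ → refl) (transduce-translateP α) (transduce-translateP β) ys
  transduce-translateP (α ∪' β) ys =
    transduce-node sCup _ _ _ _ (λ _ → refl) (transduce-translateP α) (transduce-translateP β) ys
  transduce-translateP (α ∩' β) ys =
    transduce-node sCap _ _ _ _ (λ _ → refl) (transduce-translateP α) (transduce-translateP β) ys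
  transduce-translateP (α ⋆)    ys = cong (sStar ∷_) (transduce-translateP α ys)

encoding-translate : ∀ φ → encF (translate φ) ≡ transduce false (encF φ)
encoding-translate φ = begin
    encF (translate φ)
  ≡⟨ ++-identityʳ _ ⟨
    encF (translate φ) ++ []
  ≡⟨ transduce-translate φ [] ⟨
    transduce false (encF φ ++ [])
  ≡⟨ cong (transduce false) (++-identityʳ _) ⟩
    transduce false (encF φ)
  ∎

-- Running an arbitrary Turing machine, up to blanks at the right end of the
-- tape (the tape is one-way infinite, so a trailing blank may or may not be
-- stored explicitly).
module Running (M : TM) where
  open TM M using (halt; δ)

  run-+ : ∀ a b k → run M (a + b) k ≡ run M b (run M a k)
  run-+ zero    b k = refl
  run-+ (suc a) b k = run-+ a b (step M k)

  run-suc : ∀ a k → run M (suc a) k ≡ step M (run M a k)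
  run-suc zero    k = refl
  run-suc (suc a) k = run-suc a (step M k)

  headCell : List (TSym M) → TSym M
  headCell []      = nothing
  headCell (x ∷ _) = x

  restCells : List (TSym M) → List (TSym M)
  restCells []      = []
  restCells (_ ∷ r) = r

  head-rest : ∀ xs d r → headCell (xs ++ d ∷ r) ∷ restCells (xs ++ d ∷ r) ≡ xs ++ d ∷ r
  head-rest []      d r = refl
  head-rest (x ∷ _) d r = refl

  move-right : ∀ l c r (k : Config M) → move M R' l c r k ≡ conf (Config.state k) (c ∷ l) (headCell r) (restCells r)
  move-right l c []      (conf _ _ _ _) = refl
  move-right l c (x ∷ r) (conf _ _ _ _) = refl

  Blank : TSym M → Set
  Blank x = x ≡ nothing

  data _≈_ : List (TSym M) → List (TSym M) → Set where
    blanks : ∀ {l l'} → All Blank l → All Blank l' → l ≈ l'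
    _∷_    : ∀ {l l'} x → l ≈ l' → (x ∷ l) ≈ (x ∷ l')

  ≈-refl : ∀ l → l ≈ l
  ≈-refl []      = blanks [] []
  ≈-refl (x ∷ l) = x ∷ ≈-refl l

  ≈-blanks : ∀ {l l'} → l ≈ l' → All Blank l → All Blank l'
  ≈-blanks (blanks _ b')  _       = b'
  ≈-blanks (x ∷ h)        (e ∷ b) = e ∷ ≈-blanks h b

  ≈-sym : ∀ {l l'} → l ≈ l' → l' ≈ l
  ≈-sym (blanks b b') = blanks b' b
  ≈-sym (x ∷ h)       = x ∷ ≈-sym h

  ≈-trans : ∀ {a b c} → a ≈ b → b ≈ c → a ≈ c
  ≈-trans (blanks p q)       (blanks _ r)        = blanks p r
  ≈-trans (blanks p (e ∷ q)) (x ∷ h)             = blanks p (e ∷ ≈-blanks h q)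
  ≈-trans (x ∷ h)            (blanks (e ∷ p) r)  = blanks (e ∷ ≈-blanks (≈-sym h) p) r
  ≈-trans (x ∷ h)            (.x ∷ h')           = x ∷ ≈-trans h h'

  ≈-head : ∀ {c c' r r'} → (c ∷ r) ≈ (c' ∷ r') → c ≡ c'
  ≈-head (blanks (p ∷ _) (q ∷ _)) = trans p (sym q)
  ≈-head (x ∷ h)                  = refl

  ≈-tail : ∀ {c c' r r'} → (c ∷ r) ≈ (c' ∷ r') → r ≈ r'
  ≈-tail (blanks (_ ∷ p) (_ ∷ q)) = blanks p q
  ≈-tail (x ∷ h)                  = h

  ≈-split : ∀ {r r'} → r ≈ r' → (headCell r ∷ restCells r) ≈ (headCell r' ∷ restCells r')
  ≈-split (blanks []      [])      = ≈-refl _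
  ≈-split (blanks []      (p ∷ q)) = blanks (refl ∷ []) (p ∷ q)
  ≈-split (blanks (p ∷ q) [])      = blanks (p ∷ q) (refl ∷ [])
  ≈-split (blanks (p ∷ q) (p' ∷ q')) = blanks (p ∷ q) (p' ∷ q')
  ≈-split (x ∷ h)                  = x ∷ h

  ≈-blank-end : ∀ xs → (xs ++ nothing ∷ []) ≈ xs
  ≈-blank-end []       = blanks (refl ∷ []) []
  ≈-blank-end (x ∷ xs) = x ∷ ≈-blank-end xs

  ≈-output : ∀ {a b} → a ≈ b → upToBlank M a ≡ upToBlank M b
  ≈-output (blanks []      [])      = refl
  ≈-output (blanks []      (refl ∷ _)) = refl
  ≈-output (blanks (refl ∷ _) [])   = refl
  ≈-output (blanks (refl ∷ _) (refl ∷ _)) = refl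
  ≈-output (nothing ∷ h)            = refl
  ≈-output (just x ∷ h)             = cong (just x ∷_) (≈-output h)

  _~_ : Config M → Config M → Set
  k ~ k' = (Config.state k ≡ Config.state k') × (Config.left k ≡ Config.left k') ×
           ((Config.cur k ∷ Config.right k) ≈ (Config.cur k' ∷ Config.right k'))

  ~-refl : ∀ k → k ~ k
  ~-refl k = refl , refl , ≈-refl _

  ~-trans : ∀ {a b c} → a ~ b → b ~ c → a ~ c
  ~-trans (q , l , h) (q' , l' , h') = trans q q' , trans l l' , ≈-trans h h'

  move-~ : ∀ m l c q l₀ c₀ {r r'} → r ≈ r' → move M m l c r (conf q l₀ c₀ r) ~ move M m l c r' (conf q l₀ c₀ r')
  move-~ L  []      c q l₀ c₀ h = refl , refl , c ∷ h
  move-~ L  (x ∷ l) c q l₀ c₀ h = refl , refl , x ∷ (c ∷ h)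
  move-~ N  l       c q l₀ c₀ h = refl , refl , c ∷ h
  move-~ R' l       c q l₀ c₀ {r} {r'} h
    rewrite move-right l c r (conf q l₀ c₀ r) | move-right l c r' (conf q l₀ c₀ r') = refl , refl , ≈-split h

  step-~ : ∀ {k k'} → k ~ k' → step M k ~ step M k'
  step-~ {conf q l c r} {conf .q .l c' r'} (refl , refl , h) with ≈-head h
  ... | refl with halt q
  ... | true  = refl , refl , h
  ... | false = let (q' , c' , m) = δ q c in move-~ m l c' q' l c' (≈-tail h)

  run-~ : ∀ t {k k'} → k ~ k' → run M t k ~ run M t k'
  run-~ zero    h = h
  run-~ (suc t) h = run-~ t (step-~ h)

  Reach : Config M → Config M → ℕ → Set
  Reach k k' b = Σ ℕ λ t → t ≤ b × run M t k ~ k'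

  reach-exact : ∀ {k k'} t → run M t k ≡ k' → Reach k k' t
  reach-exact t e = t , ≤-refl , subst (_~ _) (sym e) (~-refl _)

  _⟫_ : ∀ {k₁ k₂ k₃ b₁ b₂} → Reach k₁ k₂ b₁ → Reach k₂ k₃ b₂ → Reach k₁ k₃ (b₁ + b₂)
  _⟫_ {k₁} (t₁ , l₁ , h₁) (t₂ , l₂ , h₂) =
    t₁ + t₂ , +-mono-≤ l₁ l₂ , subst (_~ _) (sym (run-+ t₁ t₂ k₁)) (~-trans (run-~ t₂ h₁) h₂)
  infixl 5 _⟫_

  reach-weaken : ∀ {k k' b b'} → b ≤ b' → Reach k k' b → Reach k k' b'
  reach-weaken le (t , l , h) = t , ≤-trans l le , h

  reach-~ : ∀ {k k' k'' b} → Reach k k' b → k' ~ k'' → Reach k k'' b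
  reach-~ (t , l , h) h' = t , l , ~-trans h h'

record FinCode (A : Set) : Set where
  field
    size        : ℕ
    code        : A → Fin size
    decode      : Fin size → A
    decode-code : ∀ a → decode (code a) ≡ a
open FinCode

fin⊤ : FinCode ⊤
fin⊤ = record { size = 1 ; code = λ _ → # 0 ; decode = λ _ → tt ; decode-code = λ _ → refl }

fin⊎ : {A B : Set} → FinCode A → FinCode B → FinCode (A ⊎ B)
fin⊎ fa fb = record
  { size = size fa + size fb
  ; code = λ x → join (size fa) (size fb) (map⊎ (code fa) (code fb) x)
  ; decode = λ i → decodeSum (splitAt (size fa) i)
  ; decode-code = λ where
      (inj₁ a) → trans (cong decodeSum (splitAt-join (size fa) (size fb) (inj₁ (code fa a)))) (cong inj₁ (decode-code fa a))
      (inj₂ b) → trans (cong decodeSum (splitAt-join (size fa) (size fb) (inj₂ (code fb b)))) (cong inj₂ (decode-code fb b)) }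
  where
  decodeSum : Fin (size fa) ⊎ Fin (size fb) → _
  decodeSum = map⊎ (decode fa) (decode fb)

fin× : {A B : Set} → FinCode A → FinCode B → FinCode (A × B)
fin× fa fb = record
  { size = size fa * size fb
  ; code = λ (a , b) → combine (code fa a) (code fb b)
  ; decode = λ i → decodePair (remQuot (size fb) i)
  ; decode-code = λ (a , b) →
      trans (cong decodePair (remQuot-combine (code fa a) (code fb b))) (cong₂ _,_ (decode-code fa a) (decode-code fb b)) }
  where
  decodePair : Fin (size fa) × Fin (size fb) → _
  decodePair (i , j) = decode fa i , decode fb j

finVia : {A B : Set} → FinCode A → (f : A → B) (g : B → A) → (∀ b → f (g b) ≡ b) → FinCode B
finVia fa f g fg = record
  { size = size fa ; code = λ b → code fa (g b) ; decode = λ i → f (decode fa i)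
  ; decode-code = λ b → trans (cong f (decode-code fa (g b))) (fg b) }

finBool : FinCode Bool
finBool = finVia (fin⊎ fin⊤ fin⊤) (λ { (inj₁ _) → true ; (inj₂ _) → false })
  (λ { true → inj₁ tt ; false → inj₂ tt }) (λ { true → refl ; false → refl })

finMaybe : {A : Set} → FinCode A → FinCode (Maybe A)
finMaybe fa = finVia (fin⊎ fin⊤ fa) (λ { (inj₁ _) → nothing ; (inj₂ a) → just a })
  (λ { nothing → inj₁ tt ; (just a) → inj₂ a }) (λ { nothing → refl ; (just a) → refl })

finSym : FinCode Sym
finSym = record { size = 13 ; code = index ; decode = lookup symbols ; decode-code = lookup-index }
  where
  symbols : Vec Sym 13
  symbols = sP ∷ sA ∷ sBot ∷ sImp ∷ sBox ∷ sTest ∷ sSeq ∷ sCup ∷ sCap ∷ sStar ∷ s1 ∷ s2 ∷ sEnd ∷ []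
  index : Sym → Fin 13
  index sP = # 0
  index sA = # 1
  index sBot = # 2
  index sImp = # 3
  index sBox = # 4
  index sTest = # 5
  index sSeq = # 6
  index sCup = # 7
  index sCap = # 8
  index sStar = # 9
  index s1 = # 10
  index s2 = # 11
  index sEnd = # 12
  lookup-index : ∀ x → lookup symbols (index x) ≡ x
  lookup-index sP = refl
  lookup-index sA = refl
  lookup-index sBot = refl
  lookup-index sImp = refl
  lookup-index sBox = refl
  lookup-index sTest = refl
  lookup-index sSeq = refl
  lookup-index sCup = refl
  lookup-index sCap = refl
  lookup-index sStar = refl
  lookup-index s1 = refl
  lookup-index s2 = refl
  lookup-index sEnd = refl

finPending : FinCode Pending
finPending = record { size = 9 ; code = index ; decode = lookup pendings ; decode-code = lookup-index }
  where
  pendings : Vec Pending 9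
  pendings = var7 ∷ var6 ∷ var5 ∷ var4 ∷ var3 ∷ var2 ∷ var1 ∷ atom1 ∷ end1 ∷ []
  index : Pending → Fin 9
  index var7 = # 0
  index var6 = # 1
  index var5 = # 2
  index var4 = # 3
  index var3 = # 4
  index var2 = # 5
  index var1 = # 6
  index atom1 = # 7
  index end1 = # 8
  lookup-index : ∀ p → lookup pendings (index p) ≡ p
  lookup-index var7 = refl
  lookup-index var6 = refl
  lookup-index var5 = refl
  lookup-index var4 = refl
  lookup-index var3 = refl
  lookup-index var2 = refl
  lookup-index var1 = refl
  lookup-index atom1 = refl
  lookup-index end1 = refl

pendHead : Pending → Sym
pendHead var7  = sCap
pendHead var6  = sTest
pendHead var5  = sImp
pendHead var4  = sBot
pendHead var3  = sBot
pendHead var2  = sA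
pendHead var1  = s2
pendHead atom1 = s1
pendHead end1  = sBot

pendNext : Pending → Maybe Pending
pendNext var7  = just var6
pendNext var6  = just var5
pendNext var5  = just var4
pendNext var4  = just var3
pendNext var3  = just var2
pendNext var2  = just var1
pendNext _     = nothing

pendingSyms-unfold : ∀ p → pendingSyms p ≡ pendHead p ∷ inserted (pendNext p)
pendingSyms-unfold var7  = refl
pendingSyms-unfold var6  = refl
pendingSyms-unfold var5  = refl
pendingSyms-unfold var4  = refl
pendingSyms-unfold var3  = refl
pendingSyms-unfold var2  = refl
pendingSyms-unfold var1  = refl
pendingSyms-unfold atom1 = refl
pendingSyms-unfold end1  = refl

-- The input is
-- rewritten in place from left to right; inserting a symbol shifts the
-- remaining input one cell to the right (quadratic time overall).  Work
-- symbols are codes of Maybe Sym: just y is the first output symbol y,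
-- marked so that the left end can be found again, and nothing is a hole.
data Ctrl : Set where
  start  : Ctrl
  scan   : Bool → Ctrl                        -- rewriting input, in a transducer mode
  insert : Pending → Bool → Ctrl              -- open a hole at the head
  carry  : Maybe Sym → Pending → Bool → Ctrl  -- shift the rest right, carrying a symbol
  back   : Pending → Bool → Ctrl              -- walk left to the hole and fill it
  rewind : Ctrl                               -- walk left to the marked first cell
  done   : Ctrl

finCtrl : FinCode Ctrl
finCtrl = finVia
  (fin⊎ fin⊤ (fin⊎ finBool (fin⊎ (fin× finPending finBool)
    (fin⊎ (fin× (finMaybe finSym) (fin× finPending finBool)) (fin⊎ (fin× finPending finBool) (fin⊎ fin⊤ fin⊤))))))
  fromSum toSum from-to
  where
  CtrlSum : Set
  CtrlSum = ⊤ ⊎ (Bool ⊎ ((Pending × Bool) ⊎ ((Maybe Sym × (Pending × Bool)) ⊎ ((Pending × Bool) ⊎ (⊤ ⊎ ⊤)))))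
  fromSum : CtrlSum → Ctrl
  fromSum (inj₁ _)                                            = start
  fromSum (inj₂ (inj₁ m))                                     = scan m
  fromSum (inj₂ (inj₂ (inj₁ (p , m))))                        = insert p m
  fromSum (inj₂ (inj₂ (inj₂ (inj₁ (z , p , m)))))             = carry z p m
  fromSum (inj₂ (inj₂ (inj₂ (inj₂ (inj₁ (p , m))))))          = back p m
  fromSum (inj₂ (inj₂ (inj₂ (inj₂ (inj₂ (inj₁ _))))))         = rewind
  fromSum (inj₂ (inj₂ (inj₂ (inj₂ (inj₂ (inj₂ _))))))         = done
  toSum : Ctrl → CtrlSum
  toSum start         = inj₁ tt
  toSum (scan m)      = inj₂ (inj₁ m)
  toSum (insert p m)  = inj₂ (inj₂ (inj₁ (p , m)))
  toSum (carry z p m) = inj₂ (inj₂ (inj₂ (inj₁ (z , p , m))))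
  toSum (back p m)    = inj₂ (inj₂ (inj₂ (inj₂ (inj₁ (p , m)))))
  toSum rewind        = inj₂ (inj₂ (inj₂ (inj₂ (inj₂ (inj₁ tt)))))
  toSum done          = inj₂ (inj₂ (inj₂ (inj₂ (inj₂ (inj₂ tt)))))
  from-to : ∀ q → fromSum (toSum q) ≡ q
  from-to start         = refl
  from-to (scan m)      = refl
  from-to (insert p m)  = refl
  from-to (carry z p m) = refl
  from-to (back p m)    = refl
  from-to rewind        = refl
  from-to done          = refl

finWork : FinCode (Maybe Sym)
finWork = finMaybe finSym

-- Opaque, so that the codes are never normalised during type checking.
opaque
  ctrlCode : Ctrl → Fin (size finCtrl)
  ctrlCode = code finCtrl
  ctrlDecode : Fin (size finCtrl) → Ctrl
  ctrlDecode = decode finCtrl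
  ctrlDecode-code : ∀ q → ctrlDecode (ctrlCode q) ≡ q
  ctrlDecode-code = decode-code finCtrl
  workCode : Maybe Sym → Fin (size finWork)
  workCode = code finWork
  workDecode : Fin (size finWork) → Maybe Sym
  workDecode = decode finWork
  workDecode-code : ∀ a → workDecode (workCode a) ≡ a
  workDecode-code = decode-code finWork

Cell : Set
Cell = Maybe (Sym ⊎ Fin (size finWork))

plainCell : Sym → Cell
plainCell x = just (inj₁ x)

hole : Cell
hole = just (inj₂ (workCode nothing))

marked : Sym → Cell
marked y = just (inj₂ (workCode (just y)))

asSym : Cell → Maybe Sym
asSym (just (inj₁ x)) = just x
asSym _               = nothing

continue : Maybe Pending → Bool → Ctrl
continue nothing  m = scan m
continue (just p) m = insert p m

write : (Sym → Cell) → Bool × Sym × Maybe Pending → Ctrl × Cell × Move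
write cell (m' , y , ins) = continue ins m' , cell y , R'

transition : Ctrl → Cell → Ctrl × Cell × Move
transition start (just (inj₁ x)) = write marked (emit false x)
transition start c               = done , c , N
transition (scan m) (just (inj₁ x)) = write plainCell (emit m x)
transition (scan m) c            = rewind , c , N
transition (insert p m) c        = carry (asSym c) p m , hole , R'
transition (carry (just z) p m) c = carry (asSym c) p m , plainCell z , R'
transition (carry nothing p m) c = back p m , c , N
transition (back p m) (just (inj₂ _)) = continue (pendNext p) m , plainCell (pendHead p) , R'
transition (back p m) c          = back p m , c , L
transition rewind (just (inj₂ g)) with workDecode g
... | just y  = done , plainCell y , N
... | nothing = done , nothing , N
transition rewind c              = rewind , c , L
transition done c                = done , c , N

isDone : Ctrl → Bool
isDone done = true
isDone _    = false

reducer : TM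
reducer = record
  { nQ = size finCtrl ; nΓ = size finWork ; start = ctrlCode start
  ; halt = λ i → isDone (ctrlDecode i)
  ; δ = λ i c → let (q , c' , m) = transition (ctrlDecode i) c in ctrlCode q , c' , m }

open Running reducer

moveBy : Ctrl × Cell × Move → List Cell → List Cell → Config reducer
moveBy (q , c , m) l r = move reducer m l c r (conf (ctrlCode q) l c r)

step-ctrl : ∀ q l c r → isDone q ≡ false → step reducer (conf (ctrlCode q) l c r) ≡ moveBy (transition q c) l r
step-ctrl q l c r running =
  trans (step-code (ctrlCode q) (trans (cong isDone (ctrlDecode-code q)) running))
        (cong (λ q' → moveBy (transition q' c) l r) (ctrlDecode-code q))
  where
  step-code : ∀ i → isDone (ctrlDecode i) ≡ false → step reducer (conf i l c r) ≡ moveBy (transition (ctrlDecode i) c) l r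
  step-code i running rewrite running = refl

plains : List Sym → List Cell
plains = map plainCell

at : Ctrl → List Cell → List Sym → Config reducer
at q l w = conf (ctrlCode q) l (headCell (plains w)) (restCells (plains w))

carry-to-end : ∀ w z p m l → run reducer (suc (length w)) (at (carry (just z) p m) l w)
                             ≡ conf (ctrlCode (carry nothing p m)) (plains (z ∷ w) ʳ++ l) nothing []
carry-to-end []      z p m l rewrite step-ctrl (carry (just z) p m) l nothing [] refl = refl
carry-to-end (x ∷ w) z p m l
  rewrite step-ctrl (carry (just z) p m) l (plainCell x) (plains w) refl
        | move-right l (plainCell z) (plains w) (conf (ctrlCode (carry (just x) p m)) l (plainCell z) (plains w))
  = carry-to-end w x p m (plainCell z ∷ l)

open-hole : ∀ p m l w → run reducer (suc (length w)) (at (insert p m) l w)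
                        ≡ conf (ctrlCode (carry nothing p m)) (plains w ʳ++ hole ∷ l) nothing []
open-hole p m l []      rewrite step-ctrl (insert p m) l nothing [] refl = refl
open-hole p m l (x ∷ w)
  rewrite step-ctrl (insert p m) l (plainCell x) (plains w) refl
        | move-right l hole (plains w) (conf (ctrlCode (carry (just x) p m)) l hole (plains w))
  = carry-to-end w x p m (hole ∷ l)

data Plain : Cell → Set where
  blank : Plain nothing
  plain : ∀ x → Plain (plainCell x)

plains-plain : ∀ w → All Plain (plains w)
plains-plain []      = []
plains-plain (x ∷ w) = plain x ∷ plains-plain w

headCell-plain : ∀ xs d r → All Plain xs → Plain d → Plain (headCell (xs ++ d ∷ r))
headCell-plain []      d r _         pd = pd
headCell-plain (_ ∷ _) d r (px ∷ _)  _  = px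

Walker : Ctrl → Set
Walker q = (isDone q ≡ false) × (∀ c → Plain c → transition q c ≡ (q , c , L))

back-walks : ∀ p m → Walker (back p m)
back-walks p m = refl , λ { _ blank → refl ; _ (plain x) → refl }

rewind-walks : Walker rewind
rewind-walks = refl , λ { _ blank → refl ; _ (plain x) → refl }

step-left : ∀ q → Walker q → ∀ x l c r → Plain c →
            step reducer (conf (ctrlCode q) (x ∷ l) c r) ≡ conf (ctrlCode q) l x (c ∷ r)
step-left q (running , walks) x l c r pc rewrite step-ctrl q (x ∷ l) c r running | walks c pc = refl

walk-left : ∀ q → Walker q → ∀ xs l d r → All Plain xs → Plain d →
            run reducer (length xs) (conf (ctrlCode q) (xs ʳ++ l) d r)
            ≡ conf (ctrlCode q) l (headCell (xs ++ d ∷ r)) (restCells (xs ++ d ∷ r))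
walk-left q walker []       l d r _         _  = refl
walk-left q walker (x ∷ xs) l d r (px ∷ ps) pd
  rewrite run-suc (length xs) (conf (ctrlCode q) (xs ʳ++ x ∷ l) d r)
        | walk-left q walker xs (x ∷ l) d r ps pd
        | step-left q walker x l (headCell (xs ++ d ∷ r)) (restCells (xs ++ d ∷ r)) (headCell-plain xs d r ps pd)
        | head-rest xs d r
  = refl

insertCost : ℕ → ℕ
insertCost n = suc n + 1 + n + 1 + 1

-- Inserting one pending symbol: open a hole, walk back to it, fill it.
insert-one : ∀ p m l w → Reach (at (insert p m) l w) (at (continue (pendNext p) m) (plainCell (pendHead p) ∷ l) w)
                               (insertCost (length w))
insert-one p m l w =
  reach-~
    (reach-exact (suc (length w)) (open-hole p m l w)
     ⟫ reach-exact 1 (step-ctrl (carry nothing p m) (plains w ʳ++ hole ∷ l) nothing [] refl)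
     ⟫ reach-weaken (≤-reflexive (length-map plainCell w))
         (reach-exact (length (plains w)) (walk-left (back p m) (back-walks p m) (plains w) (hole ∷ l) nothing [] ws blank))
     ⟫ reach-exact 1 (trans (step-left (back p m) (back-walks p m) hole l _ _ (headCell-plain (plains w) nothing [] ws blank))
                            (cong (conf (ctrlCode (back p m)) l hole) (head-rest (plains w) nothing [])))
     ⟫ reach-exact 1 (trans (step-ctrl (back p m) l hole (plains w ++ nothing ∷ []) refl)
                            (move-right l (plainCell (pendHead p)) (plains w ++ nothing ∷ []) _)))
    (refl , refl , ≈-split (≈-blank-end (plains w)))
  where
  ws : All Plain (plains w)
  ws = plains-plain w

insert-all : ∀ k ins m l w → length (inserted ins) ≡ k →
             Reach (at (continue ins m) l w) (at (scan m) (plains (inserted ins) ʳ++ l) w) (k * insertCost (length w))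
insert-all zero    nothing  m l w _   = reach-exact 0 refl
insert-all (suc k) nothing  m l w ()
insert-all k       (just p) m l w len with pendingSyms p | pendingSyms-unfold p
... | _ | refl with k | len
... | suc k' | len' = insert-one p m l w ⟫ insert-all k' (pendNext p) m (plainCell (pendHead p) ∷ l) w (suc-injective len')

inserted-length : ∀ ins → length (inserted ins) ≤ 7
inserted-length nothing       = z≤n
inserted-length (just var7)   = s≤s (s≤s (s≤s (s≤s (s≤s (s≤s (s≤s z≤n))))))
inserted-length (just var6)   = s≤s (s≤s (s≤s (s≤s (s≤s (s≤s z≤n)))))
inserted-length (just var5)   = s≤s (s≤s (s≤s (s≤s (s≤s z≤n))))
inserted-length (just var4)   = s≤s (s≤s (s≤s (s≤s z≤n)))
inserted-length (just var3)   = s≤s (s≤s (s≤s z≤n))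
inserted-length (just var2)   = s≤s (s≤s z≤n)
inserted-length (just var1)   = s≤s z≤n
inserted-length (just atom1)  = s≤s z≤n
inserted-length (just end1)   = s≤s z≤n

insert-pending : ∀ ins m l w → Reach (at (continue ins m) l w) (at (scan m) (plains (inserted ins) ʳ++ l) w) (7 * insertCost (length w))
insert-pending ins m l w =
  reach-weaken (*-monoˡ-≤ (insertCost (length w)) (inserted-length ins)) (insert-all _ ins m l w refl)

insertCost-mono : ∀ {a b} → a ≤ b → insertCost a ≤ insertCost b
insertCost-mono le = +-monoˡ-≤ 1 (+-monoˡ-≤ 1 (+-mono-≤ (+-monoˡ-≤ 1 (s≤s le)) le))

scan-input : ∀ n w m l → length w ≤ n → Σ Bool λ m' →
             Reach (at (scan m) l w) (at (scan m') (plains (transduce m w) ʳ++ l) []) (length w * (1 + 7 * insertCost n))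
scan-input n []      m l _  = m , reach-exact 0 refl
scan-input n (x ∷ w) m l le with emit m x in emitted
... | m' , y , ins with scan-input n w m' (plains (inserted ins) ʳ++ plainCell y ∷ l) (≤-trans (n≤1+n _) le)
... | m'' , scanned = m'' ,
  subst (λ z → Reach (at (scan m) l (x ∷ w)) (at (scan m'') z []) _) (sym written)
    (reach-exact 1 (trans (step-ctrl (scan m) l (plainCell x) (plains w) refl)
                   (trans (cong (λ e → moveBy (write plainCell e) l (plains w)) emitted)
                          (move-right l (plainCell y) (plains w) _)))
     ⟫ reach-weaken (*-monoʳ-≤ 7 (insertCost-mono (≤-trans (n≤1+n _) le))) (insert-pending ins m' (plainCell y ∷ l) w)
     ⟫ scanned)
  where
  written : plains (y ∷ inserted ins ++ transduce m' w) ʳ++ l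
            ≡ plains (transduce m' w) ʳ++ plains (inserted ins) ʳ++ plainCell y ∷ l
  written = trans (cong (_ʳ++ plainCell y ∷ l) (map-++ plainCell (inserted ins) (transduce m' w)))
                  (++-ʳ++ (plains (inserted ins)))

rewind-marked : ∀ y → transition rewind (marked y) ≡ (done , plainCell y , N)
rewind-marked y rewrite workDecode-code (just y) = refl

output-plains : ∀ o r → upToBlank reducer (plains o ++ nothing ∷ r) ≡ plains o
output-plains []      r = refl
output-plains (x ∷ o) r = cong (plainCell x ∷_) (output-plains o r)

transduce-length : ∀ m w → length (transduce m w) ≤ 8 * length w
transduce-length m []      = z≤n
transduce-length m (x ∷ w) with emit m x
... | m' , y , ins = ≤-trans (s≤s (≤-trans (≤-reflexive (length-++ (inserted ins)))
                                           (+-mono-≤ (inserted-length ins) (transduce-length m' w))))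
                             (≤-reflexive (sym (eight-suc (length w))))
  where
  eight-suc : ∀ n → 8 * suc n ≡ suc (7 + 8 * n)
  eight-suc = solve-∀

-- Steps of a run on an input of length 1 + n producing o further symbols:
-- first cell, its insertions, the scan, the turn, the rewind, the marker.
runCost : ℕ → ℕ → ℕ
runCost n o = 1 + 7 * insertCost n + n * (1 + 7 * insertCost n) + 1 + o + 1 + 1

runCost-bound : ∀ n o → o ≤ 7 + 8 * n → runCost n o ≤ 60 * suc n ^ 2 + 60
runCost-bound n o o≤ =
  ≤-trans (+-monoˡ-≤ 1 (+-monoˡ-≤ 1 (+-monoʳ-≤ (1 + 7 * insertCost n + n * (1 + 7 * insertCost n) + 1) o≤)))
          (≤-trans (m≤m+n (runCost n (7 + 8 * n)) _) (≤-reflexive (sym (polynomial n))))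
  where
  -- runCost, insertCost and _^_ unfolded, for the ring solver
  polynomial : ∀ n → 60 * (suc n * (suc n * 1)) + 60 ≡
    (1 + 7 * (suc n + 1 + n + 1 + 1) + n * (1 + 7 * (suc n + 1 + n + 1 + 1)) + 1 + (7 + 8 * n) + 1 + 1)
    + (46 * (n * n) + 69 * n + 81)
  polynomial = solve-∀

reducer-run : ∀ x w → Σ ℕ λ t → (t ≤ 60 * suc (length w) ^ 2 + 60) ×
              Halted reducer (run reducer t (initial reducer (x ∷ w))) ×
              (output reducer (run reducer t (initial reducer (x ∷ w))) ≡ plains (transduce false (x ∷ w)))
reducer-run x w with emit false x in emitted
... | m , y , ins with scan-input (length w) w m (plains (inserted ins) ʳ++ marked y ∷ []) ≤-refl
... | m' , scanned = t , ≤-trans t≤ (runCost-bound (length w) (length (plains o)) output-length) , halted , produced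
  where
  o : List Sym
  o = inserted ins ++ transduce m w

  left : List Cell
  left = plains o ʳ++ marked y ∷ []

  left-eq : plains (transduce m w) ʳ++ plains (inserted ins) ʳ++ marked y ∷ [] ≡ left
  left-eq = sym (trans (cong (_ʳ++ marked y ∷ []) (map-++ plainCell (inserted ins) (transduce m w)))
                       (++-ʳ++ (plains (inserted ins))))

  ps : All Plain (plains o)
  ps = plains-plain o

  tape : List Cell
  tape = plains o ++ nothing ∷ []

  first-cell : run reducer 1 (initial reducer (x ∷ w)) ≡ at (continue ins m) (marked y ∷ []) w
  first-cell = trans (step-ctrl start [] (plainCell x) (plains w) refl)
               (trans (cong (λ e → moveBy (write marked e) [] (plains w)) emitted)
                      (move-right [] (marked y) (plains w) _))

  turn : run reducer 1 (at (scan m') left []) ≡ conf (ctrlCode rewind) left nothing []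
  turn = step-ctrl (scan m') left nothing [] refl

  onto-marker : run reducer 1 (conf (ctrlCode rewind) (marked y ∷ []) (headCell tape) (restCells tape))
                ≡ conf (ctrlCode rewind) [] (marked y) tape
  onto-marker = trans (step-left rewind rewind-walks (marked y) [] _ _ (headCell-plain (plains o) nothing [] ps blank))
                      (cong (conf (ctrlCode rewind) [] (marked y)) (head-rest (plains o) nothing []))

  restore : run reducer 1 (conf (ctrlCode rewind) [] (marked y) tape) ≡ conf (ctrlCode done) [] (plainCell y) tape
  restore = trans (step-ctrl rewind [] (marked y) tape refl) (cong (λ e → moveBy e [] tape) (rewind-marked y))

  phases : Reach (initial reducer (x ∷ w)) (conf (ctrlCode done) [] (plainCell y) tape) (runCost (length w) (length (plains o)))
  phases = reach-exact 1 first-cell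
         ⟫ insert-pending ins m (marked y ∷ []) w
         ⟫ subst (λ l → Reach (at (scan m) (plains (inserted ins) ʳ++ marked y ∷ []) w) (at (scan m') l []) _) left-eq scanned
         ⟫ reach-exact 1 turn
         ⟫ reach-exact (length (plains o)) (walk-left rewind rewind-walks (plains o) (marked y ∷ []) nothing [] ps blank)
         ⟫ reach-exact 1 onto-marker
         ⟫ reach-exact 1 restore

  t : ℕ
  t = proj₁ phases

  t≤ : t ≤ runCost (length w) (length (plains o))
  t≤ = proj₁ (proj₂ phases)

  final : run reducer t (initial reducer (x ∷ w)) ~ conf (ctrlCode done) [] (plainCell y) tape
  final = proj₂ (proj₂ phases)

  output-length : length (plains o) ≤ 7 + 8 * length w
  output-length = ≤-trans (≤-reflexive (trans (length-map plainCell o) (length-++ (inserted ins))))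
                          (+-mono-≤ (inserted-length ins) (transduce-length m w))

  halted : Halted reducer (run reducer t (initial reducer (x ∷ w)))
  halted = trans (cong (λ i → isDone (ctrlDecode i)) (proj₁ final)) (cong isDone (ctrlDecode-code done))

  produced : output reducer (run reducer t (initial reducer (x ∷ w))) ≡ plains (y ∷ o)
  produced = trans (≈-output (proj₂ (proj₂ final))) (cong (plainCell y ∷_) (output-plains o []))

reducer-computes : ∀ ws out → out ≡ transduce false ws → (Σ Sym λ x → Σ (List Sym) λ w → ws ≡ x ∷ w) →
                   Σ ℕ λ t → (t ≤ 60 * length ws ^ 2 + 60) ×
                   Halted reducer (run reducer t (initial reducer ws)) ×
                   (output reducer (run reducer t (initial reducer ws)) ≡ plains out)
reducer-computes _ _ refl (x , w , refl) = reducer-run x w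

encF-nonempty : ∀ φ → Σ Sym λ x → Σ (List Sym) λ w → encF φ ≡ x ∷ w
encF-nonempty (var i)   = sP , _ , refl
encF-nonempty ⊥'        = sBot , _ , refl
encF-nonempty (φ ⇒ ψ)   = sImp , _ , refl
encF-nonempty ([ α ] φ) = sBox , _ , refl

translate-polytime : PolyTime translate
translate-polytime = reducer , 60 , 2 , λ φ →
  reducer-computes (encF φ) (encF (translate φ)) (encoding-translate φ) (encF-nonempty φ)

theorem1 : Σ (Fm → Fm) λ f →
             PolyTime f ×
             ((φ : Fm) → VarFree (f φ)) ×
             ((φ : Fm) → (Valid φ → Valid (f φ)) × (Valid (f φ) → Valid φ))
theorem1 = translate , translate-polytime , translate-varFree ,
           λ φ → validity-preserved φ , validity-reflected φ
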